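{- Let $d>1$ be square-free, $K=\mathbb Q(\sqrt d)$, $\mathcal O=\mathbb Z\oplus\omega\mathbb Z$, $U$ its unit group and $\mathcal V=\{a+b\omega:a,b\in\mathbb Z,\gcd(a,b)=1\}$. (1) For every nonzero $\gamma\in\mathcal O$ there is $\alpha\in\mathcal V$ with $\gamma\sim\alpha$. (2) If $\alpha,\alpha'\in\mathcal V$ and $\alpha\sim\alpha'$, then $|N(\alpha)|=|N(\alpha')|$.
   Context: $\omega=\sqrt d$ if $d\equiv2,3\pmod4$, $\omega=(1+\sqrt d)/2$ if $d\equiv1\pmod4$; $N(\beta)=\beta\overline\beta$. For nonzero $\gamma,\gamma'\in\mathcal O$, $\gamma\sim\gamma'$ iff there exist $\upsilon\in U$ and positive integers $m,n$ with $\upsilon m\gamma'=n\gamma$. -}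

module Defs where

open import Data.Nat as ℕ using (ℕ; suc; _%_; _/_)
open import Data.Integer as ℤ using (ℤ; +_; _+_; _*_; -_; _-_; ∣_∣)
open import Data.Integer.GCD using (gcd)
open import Data.Product using (_×_; _,_; Σ; ∃; ∃-syntax)
open import Relation.Binary.PropositionalEquality using (_≡_)
open import Data.Nat.Divisibility using (_∣_)

SquareFree : ℕ → Set
SquareFree d = ∀ (p : ℕ) → (p ℕ.* p) ∣ d → p ≡ 1

-- An element a + b ω of 𝒪 = ℤ ⊕ ω ℤ is represented by the pair (a , b).
𝒪 : Set
𝒪 = ℤ × ℤ

-- ω² = c₀ + c₁ ω :
--   d ≡ 1 (mod 4): ω = (1+√d)/2, ω² = (d-1)/4 + ω
--   otherwise     : ω = √d,      ω² = d
ωsq : ℕ → ℤ × ℤ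
ωsq d with d % 4
... | 1 = (+ (d / 4) , + 1)     -- (d-1)/4 = d/4 (floor) when d ≡ 1 mod 4
... | _ = (+ d , + 0)

mul : ℕ → 𝒪 → 𝒪 → 𝒪
mul d (a , b) (e , f) with ωsq d
... | (c₀ , c₁) = (a * e + b * f * c₀ , a * f + b * e + b * f * c₁)

-- Galois conjugate: √d ↦ -√d; for ω = (1+√d)/2, ω̄ = 1 - ω
conj : ℕ → 𝒪 → 𝒪
conj d (a , b) with d % 4
... | 1 = (a + b , - b)
... | _ = (a , - b)

-- N(β) = β β̄ (always lies in ℤ, i.e. second coordinate 0); we take the ℤ-part
N : ℕ → 𝒪 → ℤ
N d β with mul d β (conj d β)
... | (n , _) = n

one : 𝒪
one = (+ 1 , + 0)

zero𝒪 : 𝒪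
zero𝒪 = (+ 0 , + 0)

ι : ℤ → 𝒪
ι n = (n , + 0)

IsUnit : ℕ → 𝒪 → Set
IsUnit d υ = ∃[ υ' ] mul d υ υ' ≡ one

In𝒱 : 𝒪 → Set
In𝒱 (a , b) = gcd a b ≡ + 1

_∼⟨_⟩_ : 𝒪 → ℕ → 𝒪 → Set
γ ∼⟨ d ⟩ γ' = ∃[ υ ] ∃[ m ] ∃[ n ]
  (IsUnit d υ × ℤ.Positive m × ℤ.Positive n ×
   mul d (mul d υ (ι m)) γ' ≡ mul d (ι n) γ)

{-# OPTIONS --safe #-}
module Submission where

-- Everything happens in ℤ[ω] with ω² = c₀ + c₁ω for arbitrary integers c₀, c₁.
-- A nonzero γ is its content (gcd of coordinates) times a primitive element.
-- Multiplying by u only forms ℤ-combinations of coordinates, so content x divides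
-- content (u x); for a unit u the reverse holds too, hence units preserve content.
-- If u m α' = n α with α, α' primitive, taking contents gives m = n, so α = u α',
-- and multiplicativity of the norm together with |N u| = 1 gives |N α| = |N α'|.

open import Defs
open import Data.Nat using (ℕ; _<_)
open import Data.Integer using (∣_∣)
open import Data.Product using (_×_; ∃-syntax)
open import Relation.Binary.PropositionalEquality using (_≡_; _≢_)

open import Data.Nat as ℕ using (suc; _%_)
import Data.Nat.Properties as ℕP
open import Data.Nat.Divisibility as ℕD using (∣-antisym)
open import Data.Nat.GCD using (gcd; gcd[m,n]∣m; gcd[m,n]∣n; gcd-greatest; c*gcd[m,n]≡gcd[cm,cn]; gcd[m,n]≡0⇒m≡0; gcd[m,n]≡0⇒n≡0)
open import Data.Integer as ℤ using (ℤ; +_; _+_; _*_; -_)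
import Data.Integer.Properties as ℤP
open import Data.Integer.Divisibility.Signed as ℤD using (divides; ∣ᵤ⇒∣; ∣⇒∣ᵤ; ∣m∣n⇒∣m+n; ∣n⇒∣m*n; ∣m⇒∣m*n)
open import Data.Integer.Tactic.RingSolver using (solve-∀)
open import Data.Product using (_,_; proj₁; proj₂)
open import Function using (_∘_)
open import Relation.Binary.PropositionalEquality using (refl; sym; trans; cong; cong₂; subst; module ≡-Reasoning)

infixr 7 _⊙_
_⊙_ : ℤ → 𝒪 → 𝒪
n ⊙ (a , b) = (n * a , n * b)

⊙-cancelˡ : ∀ n .{{_ : ℤ.NonZero n}} {x y} → n ⊙ x ≡ n ⊙ y → x ≡ y
⊙-cancelˡ n {a , b} {e , f} eq =
  cong₂ _,_ (ℤP.*-cancelˡ-≡ n a e (cong proj₁ eq)) (ℤP.*-cancelˡ-≡ n b f (cong proj₂ eq))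

content : 𝒪 → ℕ
content (a , b) = gcd ∣ a ∣ ∣ b ∣

content≡0⇒≡0 : ∀ x → content x ≡ 0 → x ≡ zero𝒪
content≡0⇒≡0 (a , b) eq =
  cong₂ _,_ (ℤP.∣i∣≡0⇒i≡0 (gcd[m,n]≡0⇒m≡0 eq)) (ℤP.∣i∣≡0⇒i≡0 (gcd[m,n]≡0⇒n≡0 ∣ a ∣ eq))

content-⊙ : ∀ n x → content (n ⊙ x) ≡ ∣ n ∣ ℕ.* content x
content-⊙ n (a , b) = begin
  gcd (∣ n * a ∣) (∣ n * b ∣)                 ≡⟨ cong₂ gcd (ℤP.abs-* n a) (ℤP.abs-* n b) ⟩
  gcd (∣ n ∣ ℕ.* ∣ a ∣) (∣ n ∣ ℕ.* ∣ b ∣)     ≡⟨ c*gcd[m,n]≡gcd[cm,cn] (∣ n ∣) (∣ a ∣) (∣ b ∣) ⟨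
  ∣ n ∣ ℕ.* gcd (∣ a ∣) (∣ b ∣)               ∎
  where open ≡-Reasoning

infix 4 _∣ᶜ_
_∣ᶜ_ : ℤ → 𝒪 → Set
g ∣ᶜ (a , b) = g ℤD.∣ a × g ℤD.∣ b

content-∣ᶜ : ∀ x → + content x ∣ᶜ x
content-∣ᶜ (a , b) = ∣ᵤ⇒∣ (gcd[m,n]∣m ∣ a ∣ ∣ b ∣) , ∣ᵤ⇒∣ (gcd[m,n]∣n ∣ a ∣ ∣ b ∣)

∣ᶜ⇒∣content : ∀ {g} x → g ∣ᶜ x → ∣ g ∣ ℕD.∣ content x
∣ᶜ⇒∣content x (g∣a , g∣b) = gcd-greatest (∣⇒∣ᵤ g∣a) (∣⇒∣ᵤ g∣b)

content-decomposition : ∀ x → content x ≢ 0 → ∃[ α ] content α ≡ 1 × + content x ⊙ α ≡ x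
content-decomposition x@(a , b) c≢0 with content-∣ᶜ x
... | divides q₁ a≡q₁c , divides q₂ b≡q₂c = α , content-α≡1 , cα≡x
  where
  open ≡-Reasoning
  c = content x
  α = (q₁ , q₂)
  cα≡x : + c ⊙ α ≡ x
  cα≡x = sym (cong₂ _,_ (trans a≡q₁c (ℤP.*-comm q₁ (+ c))) (trans b≡q₂c (ℤP.*-comm q₂ (+ c))))
  content-α≡1 : content α ≡ 1
  content-α≡1 = ℕP.*-cancelˡ-≡ (content α) 1 c {{ℕ.≢-nonZero c≢0}} (begin
    c ℕ.* content α    ≡⟨ content-⊙ (+ c) α ⟨
    content (+ c ⊙ α)  ≡⟨ cong content cα≡x ⟩
    c                  ≡⟨ ℕP.*-identityʳ c ⟨
    c ℕ.* 1            ∎)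

positive⇒+∣i∣≡i : ∀ {i} → ℤ.Positive i → + ∣ i ∣ ≡ i
positive⇒+∣i∣≡i {i} i>0 = ℤP.0≤i⇒+∣i∣≡i (ℤP.<⇒≤ (ℤP.positive⁻¹ i {{i>0}}))

positive-∣∣-injective : ∀ {m n} → ℤ.Positive m → ℤ.Positive n → ∣ m ∣ ≡ ∣ n ∣ → m ≡ n
positive-∣∣-injective m>0 n>0 eq =
  trans (sym (positive⇒+∣i∣≡i m>0)) (trans (cong +_ eq) (positive⇒+∣i∣≡i n>0))

module ℤ[ω] (c₀ c₁ : ℤ) where

  infixl 7 _·_
  _·_ : 𝒪 → 𝒪 → 𝒪
  (a , b) · (e , f) = (a * e + b * f * c₀ , a * f + b * e + b * f * c₁)

  -- ω̄ = c₁ − ω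
  conjugate : 𝒪 → 𝒪
  conjugate (a , b) = (a + b * c₁ , - b)

  norm : 𝒪 → ℤ
  norm x = proj₁ (x · conjugate x)

  ·-comm : ∀ x y → x · y ≡ y · x
  ·-comm (a , b) (e , f) = cong₂ _,_ (l a b e f c₀) (r a b e f c₁)
    where
    l : ∀ a b e f c₀ → a * e + b * f * c₀ ≡ e * a + f * b * c₀
    l = solve-∀
    r : ∀ a b e f c₁ → a * f + b * e + b * f * c₁ ≡ e * b + f * a + f * b * c₁
    r = solve-∀

  ·-assoc : ∀ x y z → (x · y) · z ≡ x · (y · z)
  ·-assoc (a , b) (e , f) (g , h) = cong₂ _,_ (l a b e f g h c₀ c₁) (r a b e f g h c₀ c₁)
    where
    l : ∀ a b e f g h c₀ c₁ →
      (a * e + b * f * c₀) * g + (a * f + b * e + b * f * c₁) * h * c₀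
        ≡ a * (e * g + f * h * c₀) + b * (e * h + f * g + f * h * c₁) * c₀
    l = solve-∀
    r : ∀ a b e f g h c₀ c₁ →
      (a * e + b * f * c₀) * h + (a * f + b * e + b * f * c₁) * g + (a * f + b * e + b * f * c₁) * h * c₁
        ≡ a * (e * h + f * g + f * h * c₁) + b * (e * g + f * h * c₀) + b * (e * h + f * g + f * h * c₁) * c₁
    r = solve-∀

  ι-· : ∀ n x → ι n · x ≡ n ⊙ x
  ι-· n (a , b) = cong₂ _,_ (l n a b c₀) (r n a b c₁)
    where
    l : ∀ n a b c₀ → n * a + + 0 * b * c₀ ≡ n * a
    l = solve-∀
    r : ∀ n a b c₁ → n * b + + 0 * a + + 0 * b * c₁ ≡ n * b
    r = solve-∀

  ·-identityˡ : ∀ x → one · x ≡ x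
  ·-identityˡ x@(a , b) = trans (ι-· (+ 1) x) (cong₂ _,_ (ℤP.*-identityˡ a) (ℤP.*-identityˡ b))

  ·-ι-⊙ : ∀ υ m x → (υ · ι m) · x ≡ m ⊙ (υ · x)
  ·-ι-⊙ υ m x = begin
    (υ · ι m) · x  ≡⟨ cong (_· x) (·-comm υ (ι m)) ⟩
    (ι m · υ) · x  ≡⟨ ·-assoc (ι m) υ x ⟩
    ι m · (υ · x)  ≡⟨ ι-· m (υ · x) ⟩
    m ⊙ (υ · x)    ∎
    where open ≡-Reasoning

  norm-· : ∀ x y → norm (x · y) ≡ norm x * norm y
  norm-· (a , b) (e , f) = l a b e f c₀ c₁
    where
    l : ∀ a b e f c₀ c₁ →
      (a * e + b * f * c₀) * ((a * e + b * f * c₀) + (a * f + b * e + b * f * c₁) * c₁)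
        + (a * f + b * e + b * f * c₁) * (- (a * f + b * e + b * f * c₁)) * c₀
      ≡ (a * (a + b * c₁) + b * (- b) * c₀) * (e * (e + f * c₁) + f * (- f) * c₀)
    l = solve-∀

  norm-one : norm one ≡ + 1
  norm-one = l c₀ c₁
    where
    l : ∀ c₀ c₁ → + 1 * (+ 1 + + 0 * c₁) + + 0 * (- + 0) * c₀ ≡ + 1
    l = solve-∀

  ∣ᶜ-· : ∀ {g} υ x → g ∣ᶜ x → g ∣ᶜ υ · x
  ∣ᶜ-· (u , v) (a , b) (g∣a , g∣b) =
    ∣m∣n⇒∣m+n (∣n⇒∣m*n u g∣a) (∣m⇒∣m*n c₀ (∣n⇒∣m*n v g∣b)) ,
    ∣m∣n⇒∣m+n (∣m∣n⇒∣m+n (∣n⇒∣m*n u g∣b) (∣n⇒∣m*n v g∣a)) (∣m⇒∣m*n c₁ (∣n⇒∣m*n v g∣b))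

  content-∣-· : ∀ υ x → content x ℕD.∣ content (υ · x)
  content-∣-· υ x = ∣ᶜ⇒∣content (υ · x) (∣ᶜ-· υ x (content-∣ᶜ x))

  Invertible : 𝒪 → Set
  Invertible υ = ∃[ υ' ] υ · υ' ≡ one

  content-invertible-· : ∀ υ x → Invertible υ → content (υ · x) ≡ content x
  content-invertible-· υ x (υ' , υυ'≡1) =
    ∣-antisym (subst (λ y → content (υ · x) ℕD.∣ content y) υ'υx≡x (content-∣-· υ' (υ · x)))
              (content-∣-· υ x)
    where
    open ≡-Reasoning
    υ'υx≡x : υ' · (υ · x) ≡ x
    υ'υx≡x = begin
      υ' · (υ · x)  ≡⟨ ·-assoc υ' υ x ⟨
      (υ' · υ) · x  ≡⟨ cong (_· x) (trans (·-comm υ' υ) υυ'≡1) ⟩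
      one · x       ≡⟨ ·-identityˡ x ⟩
      x             ∎

  ∣norm∣-invertible : ∀ υ → Invertible υ → ∣ norm υ ∣ ≡ 1
  ∣norm∣-invertible υ (υ' , υυ'≡1) = ℕP.m*n≡1⇒m≡1 (∣ norm υ ∣) (∣ norm υ' ∣) (begin
    ∣ norm υ ∣ ℕ.* ∣ norm υ' ∣  ≡⟨ ℤP.abs-* (norm υ) (norm υ') ⟨
    ∣ norm υ * norm υ' ∣        ≡⟨ cong ∣_∣ (norm-· υ υ') ⟨
    ∣ norm (υ · υ') ∣           ≡⟨ cong (∣_∣ ∘ norm) υυ'≡1 ⟩
    ∣ norm one ∣                ≡⟨ cong ∣_∣ norm-one ⟩
    1                           ∎)
    where open ≡-Reasoning

  ∣norm∣-invertible-· : ∀ υ x → Invertible υ → ∣ norm (υ · x) ∣ ≡ ∣ norm x ∣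
  ∣norm∣-invertible-· υ x υ-inv = begin
    ∣ norm (υ · x) ∣            ≡⟨ cong ∣_∣ (norm-· υ x) ⟩
    ∣ norm υ * norm x ∣         ≡⟨ ℤP.abs-* (norm υ) (norm x) ⟩
    ∣ norm υ ∣ ℕ.* ∣ norm x ∣   ≡⟨ cong (ℕ._* ∣ norm x ∣) (∣norm∣-invertible υ υ-inv) ⟩
    1 ℕ.* ∣ norm x ∣            ≡⟨ ℕP.*-identityˡ (∣ norm x ∣) ⟩
    ∣ norm x ∣                  ∎
    where open ≡-Reasoning

  infix 4 _∼_
  _∼_ : 𝒪 → 𝒪 → Set
  γ ∼ γ' = ∃[ υ ] ∃[ m ] ∃[ n ]
    (Invertible υ × ℤ.Positive m × ℤ.Positive n × (υ · ι m) · γ' ≡ ι n · γ)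

  ∼-primitive : ∀ γ → γ ≢ zero𝒪 → ∃[ α ] content α ≡ 1 × γ ∼ α
  ∼-primitive γ γ≢0 with content-decomposition γ (γ≢0 ∘ content≡0⇒≡0 γ)
  ... | α , content-α≡1 , cα≡γ = α , content-α≡1 ,
    (one , + c , + 1 , (one , ·-identityˡ one) , c>0 , _ , cα≈γ)
    where
    open ≡-Reasoning
    c = content γ
    c>0 : ℤ.Positive (+ c)
    c>0 = ℤ.positive (ℤ.+<+ (ℕP.n≢0⇒n>0 (γ≢0 ∘ content≡0⇒≡0 γ)))
    cα≈γ : (one · ι (+ c)) · α ≡ ι (+ 1) · γ
    cα≈γ = begin
      (one · ι (+ c)) · α  ≡⟨ cong (_· α) (·-identityˡ (ι (+ c))) ⟩
      ι (+ c) · α          ≡⟨ ι-· (+ c) α ⟩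
      + c ⊙ α              ≡⟨ cα≡γ ⟩
      γ                    ≡⟨ ·-identityˡ γ ⟨
      one · γ              ∎

  ∼-primitive⇒invertible-· : ∀ {α α' υ m n} → content α ≡ 1 → content α' ≡ 1 →
    Invertible υ → ℤ.Positive m → ℤ.Positive n → (υ · ι m) · α' ≡ ι n · α → υ · α' ≡ α
  ∼-primitive⇒invertible-· {α} {α'} {υ} {m} {n} cα≡1 cα'≡1 υ-inv m>0 n>0 eq =
    ⊙-cancelˡ m {{ℤ.>-nonZero (ℤP.positive⁻¹ m {{m>0}})}} mυα'≡mα
    where
    open ≡-Reasoning
    mυα'≡nα : m ⊙ (υ · α') ≡ n ⊙ α
    mυα'≡nα = trans (sym (·-ι-⊙ υ m α')) (trans eq (ι-· n α))
    ∣m∣≡∣n∣ : ∣ m ∣ ≡ ∣ n ∣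
    ∣m∣≡∣n∣ = begin
      ∣ m ∣                         ≡⟨ ℕP.*-identityʳ (∣ m ∣) ⟨
      ∣ m ∣ ℕ.* 1                   ≡⟨ cong (∣ m ∣ ℕ.*_) (trans (content-invertible-· υ α' υ-inv) cα'≡1) ⟨
      ∣ m ∣ ℕ.* content (υ · α')    ≡⟨ content-⊙ m (υ · α') ⟨
      content (m ⊙ (υ · α'))        ≡⟨ cong content mυα'≡nα ⟩
      content (n ⊙ α)               ≡⟨ content-⊙ n α ⟩
      ∣ n ∣ ℕ.* content α           ≡⟨ cong (∣ n ∣ ℕ.*_) cα≡1 ⟩
      ∣ n ∣ ℕ.* 1                   ≡⟨ ℕP.*-identityʳ (∣ n ∣) ⟩
      ∣ n ∣                         ∎
    mυα'≡mα : m ⊙ (υ · α') ≡ m ⊙ α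
    mυα'≡mα = trans mυα'≡nα (cong (_⊙ α) (sym (positive-∣∣-injective m>0 n>0 ∣m∣≡∣n∣)))

  ∼-primitive⇒∣norm∣≡ : ∀ {α α'} → content α ≡ 1 → content α' ≡ 1 → α ∼ α' →
    ∣ norm α ∣ ≡ ∣ norm α' ∣
  ∼-primitive⇒∣norm∣≡ {α} {α'} cα≡1 cα'≡1 (υ , m , n , υ-inv , m>0 , n>0 , eq) =
    trans (cong (∣_∣ ∘ norm) (sym (∼-primitive⇒invertible-· {υ = υ} cα≡1 cα'≡1 υ-inv m>0 n>0 eq)))
          (∣norm∣-invertible-· υ α' υ-inv)

a≡a+b*0 : ∀ a b → a ≡ a + b * + 0
a≡a+b*0 a b = sym (trans (cong (λ t → a + t) (ℤP.*-zeroʳ b)) (ℤP.+-identityʳ a))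

ω₀ ω₁ : ℕ → ℤ
ω₀ d = proj₁ (ωsq d)
ω₁ d = proj₂ (ωsq d)

module _ (d : ℕ) where
  open ℤ[ω] (ω₀ d) (ω₁ d)

  mul≡· : ∀ x y → mul d x y ≡ x · y
  mul≡· (a , b) (e , f) with ωsq d
  ... | _ = refl

  mul²≡·² : ∀ x y z → mul d (mul d x y) z ≡ (x · y) · z
  mul²≡·² x y z = trans (mul≡· (mul d x y) z) (cong (_· z) (mul≡· x y))

  conj≡conjugate : ∀ x → conj d x ≡ conjugate x
  conj≡conjugate (a , b) with d % 4
  ... | 0                 = cong (_, - b) (a≡a+b*0 a b)
  ... | 1                 = cong (λ t → (a + t , - b)) (sym (ℤP.*-identityʳ b))
  ... | 2                 = cong (_, - b) (a≡a+b*0 a b)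
  ... | suc (suc (suc _)) = cong (_, - b) (a≡a+b*0 a b)

  N≡norm : ∀ x → N d x ≡ norm x
  N≡norm x = trans (N≡proj₁ x) (cong proj₁ (trans (mul≡· x (conj d x)) (cong (x ·_) (conj≡conjugate x))))
    where
    N≡proj₁ : ∀ x → N d x ≡ proj₁ (mul d x (conj d x))
    N≡proj₁ x with mul d x (conj d x)
    ... | _ = refl

  IsUnit⇒Invertible : ∀ υ → IsUnit d υ → Invertible υ
  IsUnit⇒Invertible υ (υ' , υυ'≡1) = υ' , trans (sym (mul≡· υ υ')) υυ'≡1

  Invertible⇒IsUnit : ∀ υ → Invertible υ → IsUnit d υ
  Invertible⇒IsUnit υ (υ' , υυ'≡1) = υ' , trans (mul≡· υ υ') υυ'≡1

  ∼⟨⟩⇒∼ : ∀ {γ γ'} → γ ∼⟨ d ⟩ γ' → γ ∼ γ'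
  ∼⟨⟩⇒∼ {γ} {γ'} (υ , m , n , υ-unit , m>0 , n>0 , eq) =
    υ , m , n , IsUnit⇒Invertible υ υ-unit , m>0 , n>0 ,
    trans (sym (mul²≡·² υ (ι m) γ')) (trans eq (mul≡· (ι n) γ))

  ∼⇒∼⟨⟩ : ∀ {γ γ'} → γ ∼ γ' → γ ∼⟨ d ⟩ γ'
  ∼⇒∼⟨⟩ {γ} {γ'} (υ , m , n , υ-inv , m>0 , n>0 , eq) =
    υ , m , n , Invertible⇒IsUnit υ υ-inv , m>0 , n>0 ,
    trans (mul²≡·² υ (ι m) γ') (trans eq (sym (mul≡· (ι n) γ)))

lemma3 : (d : ℕ) → 1 < d → SquareFree d →
    ((γ : 𝒪) → γ ≢ zero𝒪 → ∃[ α ] (In𝒱 α × (γ ∼⟨ d ⟩ α)))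
    × ((α α' : 𝒪) → In𝒱 α → In𝒱 α' → α ∼⟨ d ⟩ α' → ∣ N d α ∣ ≡ ∣ N d α' ∣)
lemma3 d _ _ = primitive-associate , ∣N∣-associate
  where
  open ℤ[ω] (ω₀ d) (ω₁ d)

  primitive-associate : (γ : 𝒪) → γ ≢ zero𝒪 → ∃[ α ] (In𝒱 α × (γ ∼⟨ d ⟩ α))
  primitive-associate γ γ≢0 with ∼-primitive γ γ≢0
  ... | α , content-α≡1 , γ∼α = α , cong +_ content-α≡1 , ∼⇒∼⟨⟩ d γ∼α

  ∣N∣-associate : (α α' : 𝒪) → In𝒱 α → In𝒱 α' → α ∼⟨ d ⟩ α' → ∣ N d α ∣ ≡ ∣ N d α' ∣
  ∣N∣-associate α α' α∈𝒱 α'∈𝒱 α∼α' = begin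
    ∣ N d α ∣     ≡⟨ cong ∣_∣ (N≡norm d α) ⟩
    ∣ norm α ∣    ≡⟨ ∼-primitive⇒∣norm∣≡ (ℤP.+-injective α∈𝒱) (ℤP.+-injective α'∈𝒱) (∼⟨⟩⇒∼ d α∼α') ⟩
    ∣ norm α' ∣   ≡⟨ cong ∣_∣ (N≡norm d α') ⟨
    ∣ N d α' ∣    ∎
    where open ≡-Reasoning
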